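{- Fix a partition $\lambda=(\lambda_1,\dots,\lambda_n)$ with distinct parts, and let $\kappa,\mu\in S_n(\lambda)$. Then $$c^\kappa_\mu=\sum_{\overline{Q}\in \overline{\mathcal{G}}^{\kappa}_\mu} \mathrm{wt}(\overline{Q}).$$
   Context: $S_n(\lambda)$ is the set of compositions obtained by permuting the parts of $\lambda$. A signed two-line queue is a $2\times n$ array in which each position is empty or holds a ball, with at least as many balls in the bottom row as in the top, each top ball paired to a bottom ball by a strand going straight down or left-to-right without wrapping; top balls carry labels in $\mathbb Z\setminus\{0\}$, bottom balls labels in $\mathbb Z^+$, paired balls have labels of equal absolute value; a top ball labeled $a>0$ must have a ball labeled $a'\ge a$ directly below it, and if $a'=a$ the two are trivially paired (same column); a top ball labeled $-a$ has either an empty spot or a ball labeled $a'\le a$ directly below it. The bottom row is read as a composition $\mu\in\mathbb N^n$ (empty $=0$) and the top row as $\alpha\in\mathbb Z^n$; $\mathcal G^\alpha_\mu$ is the set of such queues. Pairing weights: read top balls in decreasing order of absolute value of label, right to left within equal absolute value, placing strands one at a time; unmatched bottom balls are free. If pairing $p$ joins a top ball in column $j$ to a bottom ball in column $k>j$, $\mathrm{skipped}(p)$ (resp. $\mathrm{emp}(p)$) is the number of free balls (resp. empty positions) in the bottom row in columns $j+1,\dots,k-1$, and $\mathrm{wt}(p)=\pm(1-t)t^{\mathrm{skipped}(p)+\mathrm{emp}(p)}$ with sign $+$ if the top ball is positive and $-$ if negative. Set $b^\alpha_\mu=\sum_{Q\in\mathcal G^\alpha_\mu}\prod_{p\text{ nontrivial}}\mathrm{wt}(p)$,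 $\mathrm{wt}_\alpha=\prod_{k:\alpha_k>0}x_k\prod_{k:\alpha_k<0}\frac{ -1}{t^{n-1}}$, and $c^\kappa_\nu=\sum_{\alpha:\,(|\alpha_1|,\dots,|\alpha_n|)=\kappa}\mathrm{wt}_\alpha b^\alpha_\nu$. The set $\overline{\mathcal G}^\kappa_\mu$ consists of the paired ball systems obtained from queues $Q\in\mathcal G^\alpha_\mu$ with $(|\alpha_1|,\dots,|\alpha_n|)=\kappa$ by forgetting the signs of the top-row labels. For $\overline Q\in\overline{\mathcal G}^\kappa_\mu$: each nontrivial pairing $p$ has weight $(1-t)t^{\mathrm{skipped}(p)}$; each top ball $B$ labeled $a>0$ in column $k$, with the ball below labeled $b$ ($b=0$ if vacant), has weight $x_k-\frac{1}{t^{n-1}}$ if $b=a$, $x_k$ if $b>a$, and $\frac{1}{t^{n-1}}$ if $b<a$; $\mathrm{wt}(\overline Q)$ is the product of all top-ball weights and nontrivial-pairing weights. -}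

module Defs where

open import Level using (Level)
open import Data.Nat as ℕ using (ℕ; zero; suc; _≡ᵇ_; _<ᵇ_; _≤ᵇ_)
open import Data.Integer as ℤ using (ℤ; +_; -[1+_]; ∣_∣)
open import Data.Fin as Fin using (Fin; toℕ)
open import Data.Vec as V using (Vec; []; _∷_; lookup)
open import Data.List as L using (List; []; _∷_; _++_; allFin; filterᵇ; foldr; concatMap)
open import Data.Bool.ListAction using (any; all)
open import Data.Bool using (Bool; true; false; _∧_; _∨_; not; if_then_else_)
open import Data.Maybe using (Maybe; just; nothing)
open import Algebra.Bundles using (CommutativeRing)

DistinctPartition : ∀ {n} → Vec ℕ n → Set
DistinctPartition {n} lam =
  (i j : Fin n) → i Fin.< j → lookup lam j ℕ.< lookup lam i

_==_ : ∀ {n} → Fin n → Fin n → Bool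
i == j = toℕ i ≡ᵇ toℕ j

isJust= : ∀ {n} → Maybe (Fin n) → Fin n → Bool
isJust= (just k) c = k == c
isJust= nothing  c = false

isNothing : ∀ {n} → Maybe (Fin n) → Bool
isNothing nothing  = true
isNothing (just _) = false

cols : ∀ n → List (Fin n)
cols n = allFin n

allCols : ∀ {n} → (Fin n → Bool) → Bool
allCols {n} p = all p (cols n)

countCols : ∀ {n} → (Fin n → Bool) → ℕ
countCols {n} p = L.length (filterᵇ p (cols n))

allVecs : ∀ {a} {A : Set a} → List A → (m : ℕ) → List (Vec A m)
allVecs xs zero    = [] ∷ []
allVecs xs (suc m) = concatMap (λ a → L.map (a ∷_) (allVecs xs m)) xs

-- A pairing (strand system) of a two-line array with n columns:
-- entry j is  just k  if the top ball in column j is joined by a strand to the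
-- bottom ball in column k, and nothing if top position j is empty.
Pairing : ℕ → Set
Pairing n = Vec (Maybe (Fin n)) n

allPairings : ∀ n → List (Pairing n)
allPairings n = allVecs (nothing ∷ L.map just (allFin n)) n

anyCols : ∀ {n} → (Fin n → Bool) → Bool
anyCols {n} p = any p (cols n)

-- Conditions on a pairing, only in terms of the absolute values k of the top
-- labels (0 = empty) and the bottom row μ (0 = empty):
-- every top ball is paired and empty top positions are not; strands go
-- straight down or left to right (no wrapping); paired balls have labels of
-- equal absolute value (so the bottom ball is a ball, label in ℤ⁺);
-- distinct top balls are paired to distinct bottom balls.
pairingOK : ∀ {n} → Vec ℕ n → Vec ℕ n → Pairing n → Bool
pairingOK {n} k μ π =
  allCols (λ j → checkCol j (lookup π j)) ∧
  allCols (λ j → allCols (λ j' → (j == j') ∨ not (shareTarget j j')))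
  where
  checkCol : Fin n → Maybe (Fin n) → Bool
  checkCol j nothing  = lookup k j ≡ᵇ 0
  checkCol j (just c) =
    not (lookup k j ≡ᵇ 0) ∧ (toℕ j ≤ᵇ toℕ c) ∧ (lookup μ c ≡ᵇ lookup k j)
  shareTarget : Fin n → Fin n → Bool
  shareTarget j j' = anyCols (λ c → isJust= (lookup π j) c ∧ isJust= (lookup π j') c)

absRow : ∀ {n} → Vec ℤ n → Vec ℕ n
absRow = V.map ∣_∣

-- Sign conditions for a signed two-line queue, column by column:
-- top label a > 0: the ball below has label a' ≥ a, and if a' = a the top
-- ball is trivially paired (strand straight down);
-- top label -a < 0: below is empty or a ball with label a' ≤ a.
signCol : ∀ {n} → Fin n → ℤ → ℕ → Maybe (Fin n) → Bool
signCol j (+ zero)    b p = true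
signCol j (+ (suc a)) b p = (suc a ≤ᵇ b) ∧ (not (b ≡ᵇ suc a) ∨ isJust= p j)
signCol j -[1+ a ]    b p = b ≤ᵇ suc a

signOK : ∀ {n} → Vec ℤ n → Vec ℕ n → Pairing n → Bool
signOK α μ π = allCols (λ j → signCol j (lookup α j) (lookup μ j) (lookup π j))

isQueue : ∀ {n} → Vec ℤ n → Vec ℕ n → Pairing n → Bool
isQueue α μ π = pairingOK (absRow α) μ π ∧ signOK α μ π

-- 𝒢^α_μ, as a list of pairings (each queue listed exactly once)
queues : ∀ {n} → Vec ℤ n → Vec ℕ n → List (Pairing n)
queues {n} α μ = filterᵇ (isQueue α μ) (allPairings n)

signings : ∀ {n} → Vec ℕ n → List (Vec ℤ n)
signings []            = [] ∷ []
signings (zero ∷ κ)    = L.map (+ zero ∷_) (signings κ)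
signings (suc a ∷ κ)   =
  L.map (+ suc a ∷_) (signings κ) ++ L.map (-[1+ a ] ∷_) (signings κ)

-- 𝒢̄^κ_μ : pairings (unsigned paired ball systems with top row κ, bottom μ)
-- arising from some Q ∈ 𝒢^α_μ with |α| = κ, each listed exactly once
queuesBar : ∀ {n} → Vec ℕ n → Vec ℕ n → List (Pairing n)
queuesBar {n} κ μ =
  filterᵇ (λ π → any (λ α → isQueue α μ π) (signings κ)) (allPairings n)

-- Order of placing strands: top balls are read in decreasing order of
-- (absolute value of) label, right to left within equal labels.
-- placedBefore k j' j : the strand from top column j' is placed before the
-- one from top column j.
placedBefore : ∀ {n} → Vec ℕ n → Fin n → Fin n → Bool
placedBefore k j' j =
  (lookup k j <ᵇ lookup k j') ∨ ((lookup k j ≡ᵇ lookup k j') ∧ (toℕ j <ᵇ toℕ j'))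

-- bottom column c holds a free ball at the moment the strand from top column
-- j is placed (a ball not yet matched by an earlier strand)
freeAt : ∀ {n} → Vec ℕ n → Vec ℕ n → Pairing n → Fin n → Fin n → Bool
freeAt k μ π j c =
  not (lookup μ c ≡ᵇ 0) ∧
  not (anyCols (λ j' → placedBefore k j' j ∧ isJust= (lookup π j') c))

strictlyBetween : ∀ {n} → Fin n → Fin n → Fin n → Bool
strictlyBetween j k c = (toℕ j <ᵇ toℕ c) ∧ (toℕ c <ᵇ toℕ k)

skipped : ∀ {n} → Vec ℕ n → Vec ℕ n → Pairing n → Fin n → Fin n → ℕ
skipped k μ π j kc = countCols (λ c → strictlyBetween j kc c ∧ freeAt k μ π j c)

emp : ∀ {n} → Vec ℕ n → Fin n → Fin n → ℕ
emp μ j kc = countCols (λ c → strictlyBetween j kc c ∧ (lookup μ c ≡ᵇ 0))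

-- Weights, valued in a commutative ring R containing t, an inverse tinv
-- of t, and x₁,…,xₙ.

module Weights {c ℓ : Level} (R : CommutativeRing c ℓ) where
  open CommutativeRing R

  pow : Carrier → ℕ → Carrier
  pow a zero    = 1#
  pow a (suc m) = a * pow a m

  sumL : List Carrier → Carrier
  sumL = foldr _+_ 0#

  prodL : List Carrier → Carrier
  prodL = foldr _*_ 1#

  prodCols : ∀ {n} → (Fin n → Carrier) → Carrier
  prodCols {n} f = prodL (L.map f (cols n))

  module _ (t tinv : Carrier) {n : ℕ} (x : Fin n → Carrier) where

    tInvPow : Carrier
    tInvPow = pow tinv (n ℕ.∸ 1)

    signedStrand : ℤ → ℕ → Carrier
    signedStrand -[1+ a ] e = - ((1# - t) * pow t e)
    signedStrand (+ a)    e = (1# - t) * pow t e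

    queueWt : Vec ℤ n → Vec ℕ n → Pairing n → Carrier
    queueWt α μ π = prodCols (λ j → strandWt j (lookup π j))
      where
      strandWt : Fin n → Maybe (Fin n) → Carrier
      strandWt j nothing  = 1#
      strandWt j (just kc) =
        if toℕ j <ᵇ toℕ kc
        then signedStrand (lookup α j)
               (skipped (absRow α) μ π j kc ℕ.+ emp μ j kc)
        else 1#

    bCoef : Vec ℤ n → Vec ℕ n → Carrier
    bCoef α μ = sumL (L.map (queueWt α μ) (queues α μ))

    wtα : Vec ℤ n → Carrier
    wtα α = prodCols (λ j → f j (lookup α j))
      where
      f : Fin n → ℤ → Carrier
      f j (+ zero)    = 1#
      f j (+ (suc a)) = x j
      f j -[1+ a ]    = - tInvPow

    cCoef : Vec ℕ n → Vec ℕ n → Carrier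
    cCoef κ ν = sumL (L.map (λ α → wtα α * bCoef α ν) (signings κ))

    barWt : Vec ℕ n → Vec ℕ n → Pairing n → Carrier
    barWt κ μ π = prodCols (λ j → topWt j * strandWt j (lookup π j))
      where
      topWt : Fin n → Carrier
      topWt j =
        if lookup κ j ≡ᵇ 0 then 1#
        else (if lookup μ j ≡ᵇ lookup κ j then x j - tInvPow
        else (if lookup κ j <ᵇ lookup μ j then x j
        else tInvPow))
      strandWt : Fin n → Maybe (Fin n) → Carrier
      strandWt j nothing  = 1#
      strandWt j (just kc) =
        if toℕ j <ᵇ toℕ kc then (1# - t) * pow t (skipped κ μ π j kc) else 1#

    barSum : Vec ℕ n → Vec ℕ n → Carrier
    barSum κ μ = sumL (L.map (barWt κ μ) (queuesBar κ μ))

-- The signed queues with top row of absolute values κ and a given pairing π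
-- are exactly the sign choices α meeting a condition column by column, and
-- all weights involved are products over columns.  So, after exchanging the
-- sums over α and π, the sum over α factors into a product of column sums of
-- at most two terms, one per sign, and each column sum is the factor of that
-- column in wt(Q̄).  This needs emp(p) = 0 for every strand p: with distinct
-- labels, an empty bottom position under a strand would make the columns up
-- to it inject into the columns strictly before it.

module Submission where

open import Defs
open import Level using (Level)
open import Data.Nat as ℕ using (ℕ; zero; suc; _≡ᵇ_; _<ᵇ_; _≤ᵇ_)
import Data.Nat.Properties as ℕ
open import Data.Integer using (ℤ; +_; -[1+_])
open import Data.Fin as Fin using (Fin; toℕ; _≟_)
import Data.Fin.Properties as Fin
open import Data.Vec as Vec using (Vec; []; _∷_; lookup; toList)
open import Data.Vec.Properties using (tabulate∘lookup)
import Data.Vec.Membership.Propositional as VecMembership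
open import Data.Vec.Membership.Propositional.Properties using (∈-lookup; ∈-toList⁺; ∈-toList⁻)
open import Data.Vec.Relation.Unary.Any using (index)
open import Data.Vec.Relation.Unary.Any.Properties using (lookup-index)
import Data.Vec.Relation.Unary.All.Properties as VecAll
import Data.Vec.Relation.Unary.AllPairs as VecPairs
open VecPairs using ([]; _∷_)
import Data.Vec.Relation.Unary.Unique.Propositional as VecUnique
import Data.Vec.Relation.Unary.Unique.Propositional.Properties as VecUniqueₚ
open import Data.List as List using (List; []; _∷_; _++_; allFin; filterᵇ)
open import Data.List.Properties using (map-tabulate; map-∘; filter-none)
open import Data.List.Membership.Propositional.Properties using (∈-allFin)
open import Data.List.Relation.Unary.All as All using (All; []; _∷_)
import Data.List.Relation.Unary.All.Properties as AllP
import Data.List.Relation.Unary.AllPairs as ListPairs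
open ListPairs using ([]; _∷_)
open import Data.List.Relation.Binary.Permutation.Propositional using (_↭_; ↭-sym; ↭-trans; ↭⇒↭ₛ)
open import Data.List.Relation.Binary.Permutation.Propositional.Properties using (∈-resp-↭)
import Data.List.Relation.Binary.Permutation.Setoid.Properties as Perm
open import Data.Bool using (Bool; true; false; T; not; _∧_; if_then_else_)
open import Data.Bool.Properties using (T-∧; T-∨; T?; ∨-∧-commutativeSemiring)
open import Data.Bool.ListAction using (any; all)
open import Data.Maybe using (Maybe; just; nothing)
open import Data.Product using (∃-syntax; _×_; _,_; proj₁; proj₂)
open import Data.Sum using (inj₂)
open import Data.Empty using (⊥; ⊥-elim)
open import Algebra.Bundles using (CommutativeMonoid; CommutativeSemiring; CommutativeRing)
open import Function using (_∘_; id; Equivalence; Injective)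
open import Relation.Nullary using (¬_; yes; no; contradiction)
open import Relation.Binary using (Rel; tri<; tri≈; tri>)
open import Relation.Binary.PropositionalEquality as ≡ using (_≡_; _≢_)

signs : ℕ → List ℤ
signs zero    = + zero ∷ []
signs (suc a) = + suc a ∷ -[1+ a ] ∷ []

absRow-signings : ∀ {m} (κ : Vec ℕ m) → All (λ α → absRow α ≡ κ) (signings κ)
absRow-signings []          = ≡.refl ∷ []
absRow-signings (zero ∷ κ)  = AllP.map⁺ (All.map (≡.cong (zero ∷_)) (absRow-signings κ))
absRow-signings (suc a ∷ κ) = AllP.++⁺ (AllP.map⁺ tails) (AllP.map⁺ tails)
  where
  tails : All (λ α → suc a ∷ absRow α ≡ suc a ∷ κ) (signings κ)
  tails = All.map (≡.cong (suc a ∷_)) (absRow-signings κ)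

map-allFin-suc : ∀ {a} {A : Set a} {m} (f : Fin (suc m) → A) →
  List.map f (allFin (suc m)) ≡ f Fin.zero ∷ List.map (f ∘ Fin.suc) (allFin m)
map-allFin-suc f =
  ≡.trans (map-tabulate id f) (≡.cong (f Fin.zero ∷_) (≡.sym (map-tabulate id (f ∘ Fin.suc))))

module MonoidSums {c ℓ} (M : CommutativeMonoid c ℓ) where
  open CommutativeMonoid M
  open import Algebra.Properties.CommutativeSemigroup commutativeSemigroup using (x∙yz≈y∙xz)
  open import Relation.Binary.Reasoning.Setoid setoid

  private
    variable
      a b : Level
      A : Set a
      B : Set b

  ∑ : List A → (A → Carrier) → Carrier
  ∑ xs f = List.foldr _∙_ ε (List.map f xs)

  syntax ∑ xs (λ x → e) = ∑[ x ∈ xs ] e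

  ∑-congᴬ : ∀ {f g : A → Carrier} {xs} → All (λ y → f y ≈ g y) xs → ∑ xs f ≈ ∑ xs g
  ∑-congᴬ []          = refl
  ∑-congᴬ (fy≈gy ∷ p) = ∙-cong fy≈gy (∑-congᴬ p)

  ∑-cong : ∀ {f g : A → Carrier} xs → (∀ y → f y ≈ g y) → ∑ xs f ≈ ∑ xs g
  ∑-cong xs f≈g = ∑-congᴬ (All.universal f≈g xs)

  ∑-map : ∀ (f : B → Carrier) (h : A → B) xs → ∑ (List.map h xs) f ≡ ∑ xs (f ∘ h)
  ∑-map f h xs = ≡.cong (List.foldr _∙_ ε) (≡.sym (map-∘ xs))

  ∑-++ : ∀ (f : A → Carrier) xs ys → ∑ (xs ++ ys) f ≈ ∑ xs f ∙ ∑ ys f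
  ∑-++ f []       ys = sym (identityˡ _)
  ∑-++ f (x ∷ xs) ys = trans (∙-cong refl (∑-++ f xs ys)) (sym (assoc _ _ _))

  ∑-ε : ∀ (xs : List A) → ∑[ _ ∈ xs ] ε ≈ ε
  ∑-ε []       = refl
  ∑-ε (x ∷ xs) = trans (identityˡ _) (∑-ε xs)

  ∑-∙ : ∀ (f g : A → Carrier) xs → ∑ xs f ∙ ∑ xs g ≈ ∑[ y ∈ xs ] (f y ∙ g y)
  ∑-∙ f g []       = identityˡ ε
  ∑-∙ f g (x ∷ xs) = begin
    (f x ∙ ∑ xs f) ∙ (g x ∙ ∑ xs g)  ≈⟨ assoc (f x) _ _ ⟩
    f x ∙ (∑ xs f ∙ (g x ∙ ∑ xs g))  ≈⟨ ∙-cong refl (x∙yz≈y∙xz _ _ _) ⟩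
    f x ∙ (g x ∙ (∑ xs f ∙ ∑ xs g))  ≈⟨ assoc (f x) (g x) _ ⟨
    (f x ∙ g x) ∙ (∑ xs f ∙ ∑ xs g)  ≈⟨ ∙-cong refl (∑-∙ f g xs) ⟩
    (f x ∙ g x) ∙ ∑[ y ∈ xs ] (f y ∙ g y) ∎

  ∑-comm : ∀ (g : A → B → Carrier) xs ys →
    ∑[ x ∈ xs ] ∑[ y ∈ ys ] g x y ≈ ∑[ y ∈ ys ] ∑[ x ∈ xs ] g x y
  ∑-comm g []       ys = sym (∑-ε ys)
  ∑-comm g (x ∷ xs) ys = trans (∙-cong refl (∑-comm g xs ys)) (∑-∙ (g x) _ ys)

module SemiringSums {c ℓ} (S : CommutativeSemiring c ℓ) where
  open CommutativeSemiring S
  open MonoidSums +-commutativeMonoid public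
  private module Products = MonoidSums *-commutativeMonoid
  open import Relation.Binary.Reasoning.Setoid setoid

  private
    variable
      a : Level
      A : Set a

  ∏ : List A → (A → Carrier) → Carrier
  ∏ = Products.∑

  syntax ∏ xs (λ x → e) = ∏[ x ∈ xs ] e

  ∏-cong : ∀ {f g : A → Carrier} xs → (∀ y → f y ≈ g y) → ∏ xs f ≈ ∏ xs g
  ∏-cong = Products.∑-cong

  ∏-* : ∀ (f g : A → Carrier) xs → ∏ xs f * ∏ xs g ≈ ∏[ y ∈ xs ] (f y * g y)
  ∏-* = Products.∑-∙

  *-∑ : ∀ u (f : A → Carrier) xs → u * ∑ xs f ≈ ∑[ y ∈ xs ] (u * f y)
  *-∑ u f []       = zeroʳ u
  *-∑ u f (x ∷ xs) = trans (distribˡ u (f x) _) (+-cong refl (*-∑ u f xs))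

  ∑-* : ∀ u (f : A → Carrier) xs → ∑ xs f * u ≈ ∑[ y ∈ xs ] (f y * u)
  ∑-* u f []       = zeroˡ u
  ∑-* u f (x ∷ xs) = trans (distribʳ u (f x) _) (+-cong refl (∑-* u f xs))

  infixl 5 _when_

  _when_ : Carrier → Bool → Carrier
  X when b = if b then X else 0#

  *-when : ∀ u X (b : Bool) → u * (X when b) ≈ u * X when b
  *-when u X true  = refl
  *-when u X false = zeroʳ u

  when-cong : ∀ {X Y} (b : Bool) → X ≈ Y → X when b ≈ Y when b
  when-cong true  X≈Y = X≈Y
  when-cong false X≈Y = refl

  ∑-filterᵇ : ∀ (p : A → Bool) (f : A → Carrier) xs →
    ∑ (filterᵇ p xs) f ≈ ∑[ y ∈ xs ] (f y when p y)
  ∑-filterᵇ p f []       = refl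
  ∑-filterᵇ p f (x ∷ xs) with p x
  ... | true  = +-cong refl (∑-filterᵇ p f xs)
  ... | false = trans (∑-filterᵇ p f xs) (sym (+-identityˡ _))

  ∏-all : ∀ (p : A → Bool) (f : A → Carrier) xs →
    ∏ xs f when all p xs ≈ ∏[ y ∈ xs ] (f y when p y)
  ∏-all p f []       = refl
  ∏-all p f (x ∷ xs) with p x
  ... | true  = trans (sym (*-when (f x) _ (all p xs))) (*-cong refl (∏-all p f xs))
  ... | false = sym (zeroˡ _)

  ∏-allFin-suc : ∀ {m} (f : Fin (suc m) → Carrier) →
    ∏ (allFin (suc m)) f ≡ f Fin.zero * ∏[ j ∈ allFin m ] f (Fin.suc j)
  ∏-allFin-suc f = ≡.cong (List.foldr _*_ 1#) (map-allFin-suc f)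

  ∑-signings-∷ : ∀ {m} k (κ : Vec ℕ m) (f : Vec ℤ (suc m) → Carrier) →
    ∑ (signings (k ∷ κ)) f ≈ ∑[ s ∈ signs k ] ∑[ α ∈ signings κ ] f (s ∷ α)
  ∑-signings-∷ zero    κ f =
    trans (reflexive (∑-map f _ (signings κ))) (sym (+-identityʳ _))
  ∑-signings-∷ (suc a) κ f = begin
    ∑ (List.map (+ suc a ∷_) (signings κ) ++ List.map (-[1+ a ] ∷_) (signings κ)) f
      ≈⟨ ∑-++ f (List.map (+ suc a ∷_) (signings κ)) _ ⟩
    ∑ (List.map (+ suc a ∷_) (signings κ)) f + ∑ (List.map (-[1+ a ] ∷_) (signings κ)) f
      ≡⟨ ≡.cong₂ _+_ (∑-map f _ (signings κ)) (∑-map f _ (signings κ)) ⟩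
    ∑[ α ∈ signings κ ] f (+ suc a ∷ α) + ∑[ α ∈ signings κ ] f (-[1+ a ] ∷ α)
      ≈⟨ +-cong refl (sym (+-identityʳ _)) ⟩
    ∑[ s ∈ signs (suc a) ] ∑[ α ∈ signings κ ] f (s ∷ α) ∎

  ∑-signings : ∀ {m} (κ : Vec ℕ m) (h : Fin m → ℤ → Carrier) →
    ∑[ α ∈ signings κ ] ∏[ j ∈ allFin m ] h j (lookup α j) ≈
    ∏[ j ∈ allFin m ] ∑[ s ∈ signs (lookup κ j) ] h j s
  ∑-signings []      h = +-identityʳ 1#
  ∑-signings (k ∷ κ) h = begin
    ∑[ α ∈ signings (k ∷ κ) ] ∏[ j ∈ allFin _ ] h j (lookup α j)
      ≈⟨ ∑-signings-∷ k κ _ ⟩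
    ∑[ s ∈ signs k ] ∑[ α ∈ signings κ ] ∏[ j ∈ allFin _ ] h j (lookup (s ∷ α) j)
      ≈⟨ ∑-cong (signs k) (λ s → ∑-cong (signings κ) (reflexive ∘ split s)) ⟩
    ∑[ s ∈ signs k ] ∑[ α ∈ signings κ ] (h Fin.zero s * rest α)
      ≈⟨ ∑-cong (signs k) (λ s → sym (*-∑ (h Fin.zero s) rest (signings κ))) ⟩
    ∑[ s ∈ signs k ] (h Fin.zero s * ∑ (signings κ) rest)
      ≈⟨ ∑-cong (signs k) (λ s → *-cong refl (∑-signings κ (h ∘ Fin.suc))) ⟩
    ∑[ s ∈ signs k ] (h Fin.zero s * ∏ (allFin _) restSums)
      ≈⟨ ∑-* _ (h Fin.zero) (signs k) ⟨
    ∑ (signs k) (h Fin.zero) * ∏ (allFin _) restSums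
      ≡⟨ ∏-allFin-suc (λ j → ∑ (signs (lookup (k ∷ κ) j)) (h j)) ⟨
    ∏[ j ∈ allFin _ ] ∑ (signs (lookup (k ∷ κ) j)) (h j) ∎
    where
    rest : Vec ℤ _ → Carrier
    rest α = ∏[ j ∈ allFin _ ] h (Fin.suc j) (lookup α j)
    restSums : Fin _ → Carrier
    restSums j = ∑ (signs (lookup κ j)) (h (Fin.suc j))
    split : ∀ s α → ∏[ j ∈ allFin _ ] h j (lookup (s ∷ α) j) ≡ h Fin.zero s * rest α
    split s α = ∏-allFin-suc (λ j → h j (lookup (s ∷ α) j))

module _ {a r} {A : Set a} {R : Rel A r} where

  AllPairs-toList⁺ : ∀ {n} {xs : Vec A n} →
    VecPairs.AllPairs R xs → ListPairs.AllPairs R (toList xs)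
  AllPairs-toList⁺ []         = []
  AllPairs-toList⁺ (rx ∷ rxs) = VecAll.toList⁺ rx ∷ AllPairs-toList⁺ rxs

  AllPairs-toList⁻ : ∀ {n} {xs : Vec A n} →
    ListPairs.AllPairs R (toList xs) → VecPairs.AllPairs R xs
  AllPairs-toList⁻ {xs = []}    []         = []
  AllPairs-toList⁻ {xs = _ ∷ _} (rx ∷ rxs) = VecAll.toList⁻ rx ∷ AllPairs-toList⁻ rxs

distinct-injective : ∀ {n} {lam : Vec ℕ n} → DistinctPartition lam →
  Injective _≡_ _≡_ (lookup lam)
distinct-injective {lam = lam} strict {i} {j} eq with Fin.<-cmp i j
... | tri< i<j _ _ = contradiction (≡.sym eq) (ℕ.<⇒≢ (strict i j i<j))
... | tri≈ _ i≡j _ = i≡j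
... | tri> _ _ j<i = contradiction eq (ℕ.<⇒≢ (strict j i j<i))

permutation-injective : ∀ {n} {lam v : Vec ℕ n} → DistinctPartition lam →
  toList v ↭ toList lam → Injective _≡_ _≡_ (lookup v)
permutation-injective {lam = lam} {v} strict v↭lam =
  VecUniqueₚ.lookup-injective v-unique _ _
  where
  lam-unique : VecUnique.Unique lam
  lam-unique = ≡.subst VecUnique.Unique (tabulate∘lookup lam)
                 (VecUniqueₚ.tabulate⁺ (distinct-injective {lam = lam} strict))
  v-unique : VecUnique.Unique v
  v-unique = AllPairs-toList⁻ (Perm.Unique-resp-↭ (≡.setoid ℕ) (↭⇒↭ₛ (↭-sym v↭lam))
                                 (AllPairs-toList⁺ lam-unique))

Covers : ∀ {n} → Vec ℕ n → Vec ℕ n → Set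
Covers κ μ = ∀ i → ∃[ p ] lookup κ p ≡ lookup μ i

permutation-covers : ∀ {n} {κ μ : Vec ℕ n} → toList μ ↭ toList κ → Covers κ μ
permutation-covers {κ = κ} {μ} μ↭κ i = index μi∈κ , ≡.sym (lookup-index μi∈κ)
  where
  μi∈κ : lookup μ i VecMembership.∈ κ
  μi∈κ = ∈-toList⁻ (∈-resp-↭ μ↭κ (∈-toList⁺ (∈-lookup i μ)))

prefix-pigeonhole : ∀ {n} (c : Fin n) (φ : Fin n → Fin n) →
  (∀ {i} → i Fin.≤ c → φ i Fin.< c) →
  (∀ {i i′} → i Fin.≤ c → i′ Fin.≤ c → φ i ≡ φ i′ → i ≡ i′) → ⊥
prefix-pigeonhole {n} c φ φ<c φ-injective = ℕ.1+n≰n (Fin.injective⇒≤ f-injective)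
  where
  ι : Fin (suc (toℕ c)) → Fin n
  ι k = Fin.inject≤ k (Fin.toℕ<n c)
  ι≤c : ∀ k → ι k Fin.≤ c
  ι≤c k = ℕ.≤-trans (ℕ.≤-reflexive (Fin.toℕ-inject≤ k _)) (Fin.toℕ≤pred[n] k)
  f : Fin (suc (toℕ c)) → Fin (toℕ c)
  f k = Fin.fromℕ< (φ<c (ι≤c k))
  f-injective : ∀ {k k′} → f k ≡ f k′ → k ≡ k′
  f-injective {k} {k′} eq =
    Fin.inject≤-injective _ _ k k′
      (φ-injective (ι≤c k) (ι≤c k′)
        (Fin.toℕ-injective (Fin.fromℕ<-injective _ _ (φ<c (ι≤c k)) (φ<c (ι≤c k′)) eq)))

module Strands {n} (κ μ : Vec ℕ n) (π : Pairing n) where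

  StrandOK : Fin n → Maybe (Fin n) → Set
  StrandOK j nothing  = lookup κ j ≡ 0
  StrandOK j (just c) = lookup κ j ≢ 0 × j Fin.≤ c × lookup μ c ≡ lookup κ j

  private
    nonzero : ∀ k → T (not (k ≡ᵇ 0)) → k ≢ 0
    nonzero (suc k) _ ()

  pairingOK⇒StrandOK : T (pairingOK κ μ π) → ∀ j → StrandOK j (lookup π j)
  pairingOK⇒StrandOK ok j with lookup π j
                   | All.lookup (AllP.all⁺ _ (allFin n) (proj₁ (Equivalence.to T-∧ ok))) (∈-allFin j)
  ... | nothing | κj≡ᵇ0 = ℕ.≡ᵇ⇒≡ _ 0 κj≡ᵇ0
  ... | just c  | okj =
    let (κj≢0 , j≤c∧μc≡κj) = Equivalence.to T-∧ okj
        (j≤c , μc≡κj)      = Equivalence.to T-∧ j≤c∧μc≡κj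
    in nonzero _ κj≢0 , ℕ.≤ᵇ⇒≤ (toℕ j) (toℕ c) j≤c , ℕ.≡ᵇ⇒≡ _ _ μc≡κj

  module _ (ok : T (pairingOK κ μ π)) (μ-injective : Injective _≡_ _≡_ (lookup μ))
           (covers : Covers κ μ) where

    strand-target : ∀ {j c i} → lookup π j ≡ just c → lookup κ j ≡ lookup μ i → c ≡ i
    strand-target {j} πj≡c κj≡μi =
      let (_ , _ , μc≡κj) = ≡.subst (StrandOK j) πj≡c (pairingOK⇒StrandOK ok j)
      in μ-injective (≡.trans μc≡κj κj≡μi)

    strand-source : ∀ {p i} → lookup κ p ≡ lookup μ i → lookup μ i ≢ 0 → p Fin.≤ i
    strand-source {p} κp≡μi μi≢0 with lookup π p | pairingOK⇒StrandOK ok p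
    ... | nothing | κp≡0             = contradiction (≡.trans (≡.sym κp≡μi) κp≡0) μi≢0
    ... | just q  | (_ , p≤q , μq≡κp) = ≡.subst (p Fin.≤_) (μ-injective (≡.trans μq≡κp κp≡μi)) p≤q

    -- If the bottom position i were empty, the columns ≤ i would be sent
    -- injectively into the columns < i: i itself to the source j of the strand
    -- passing over it, every other column to the source of its ball.
    no-empty-under-strand : ∀ {j c i} → lookup π j ≡ just c → j Fin.< i → i Fin.< c →
                            lookup μ i ≢ 0
    no-empty-under-strand {j} {c} {i} πj≡c j<i i<c μi≡0 = prefix-pigeonhole i φ φ<i φ-injective
      where
      φ : Fin n → Fin n
      φ i′ with i′ ≟ i
      ... | yes _ = j
      ... | no  _ = proj₁ (covers i′)

      μ≢0 : ∀ {i′} → i′ ≢ i → lookup μ i′ ≢ 0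
      μ≢0 i′≢i μi′≡0 = i′≢i (μ-injective (≡.trans μi′≡0 (≡.sym μi≡0)))

      φ<i : ∀ {i′} → i′ Fin.≤ i → φ i′ Fin.< i
      φ<i {i′} i′≤i with i′ ≟ i
      ... | yes _    = j<i
      ... | no i′≢i = ℕ.≤-<-trans (strand-source (proj₂ (covers i′)) (μ≢0 i′≢i))
                                    (Fin.≤∧≢⇒< i′≤i i′≢i)

      j≢source : ∀ {i′} → i′ Fin.≤ i → j ≢ proj₁ (covers i′)
      j≢source {i′} i′≤i j≡p =
        let c≡i′ = strand-target πj≡c (≡.trans (≡.cong (lookup κ) j≡p) (proj₂ (covers i′)))
        in ℕ.<⇒≱ i<c (≡.subst (Fin._≤ i) (≡.sym c≡i′) i′≤i)

      φ-injective : ∀ {i₁ i₂} → i₁ Fin.≤ i → i₂ Fin.≤ i → φ i₁ ≡ φ i₂ → i₁ ≡ i₂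
      φ-injective {i₁} {i₂} i₁≤i i₂≤i eq with i₁ ≟ i | i₂ ≟ i
      ... | yes i₁≡i | yes i₂≡i = ≡.trans i₁≡i (≡.sym i₂≡i)
      ... | yes _    | no _     = ⊥-elim (j≢source i₂≤i eq)
      ... | no _     | yes _    = ⊥-elim (j≢source i₁≤i (≡.sym eq))
      ... | no _     | no _     =
        μ-injective (≡.trans (≡.sym (proj₂ (covers i₁)))
                             (≡.trans (≡.cong (lookup κ) eq) (proj₂ (covers i₂))))

    emp-vanishes : ∀ {j c} → lookup π j ≡ just c → emp μ j c ≡ 0
    emp-vanishes {j} {c} πj≡c =
      ≡.cong List.length (filter-none (T? ∘ emptyBetween) (All.universal ¬emptyBetween (allFin n)))
      where
      emptyBetween : Fin n → Bool
      emptyBetween i = strictlyBetween j c i ∧ (lookup μ i ≡ᵇ 0)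
      ¬emptyBetween : ∀ i → ¬ T (emptyBetween i)
      ¬emptyBetween i t =
        let (between , μi≡0) = Equivalence.to T-∧ t
            (j<i , i<c)      = Equivalence.to T-∧ between
        in no-empty-under-strand πj≡c (ℕ.<ᵇ⇒< _ _ j<i) (ℕ.<ᵇ⇒< _ _ i<c) (ℕ.≡ᵇ⇒≡ _ 0 μi≡0)

T⇒≡true : ∀ {b} → T b → b ≡ true
T⇒≡true {true} _ = ≡.refl

¬T⇒≡false : ∀ {b} → ¬ T b → b ≡ false
¬T⇒≡false {true}  ¬b = ⊥-elim (¬b _)
¬T⇒≡false {false} _  = ≡.refl

-- any and all are ∑ and ∏ in the Boolean semiring (∨, ∧).
module BoolSums = SemiringSums ∨-∧-commutativeSemiring

signCol-satisfiable : ∀ {n} (j : Fin n) k m p → T (any (λ s → signCol j s m p) (signs k))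
signCol-satisfiable j zero    m p = _
signCol-satisfiable j (suc a) m p with m ℕ.≤? suc a
... | yes m≤k
  rewrite T⇒≡true (ℕ.≤⇒≤ᵇ m≤k) = Equivalence.from (T-∨ {signCol j (+ suc a) m p}) (inj₂ _)
... | no  m≰k
  rewrite T⇒≡true {a <ᵇ m} (ℕ.<⇒<ᵇ (ℕ.<-trans (ℕ.n<1+n a) (ℕ.≰⇒> m≰k)))
        | ¬T⇒≡false {m ≡ᵇ suc a} (m≰k ∘ ℕ.≤-reflexive ∘ ℕ.≡ᵇ⇒≡ m (suc a))
  = _

signOK-satisfiable : ∀ {n} (κ μ : Vec ℕ n) π → any (λ α → signOK α μ π) (signings κ) ≡ true
signOK-satisfiable {n} κ μ π =
  ≡.trans (BoolSums.∑-signings κ (λ j s → signCol j s (lookup μ j) (lookup π j)))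
          (T⇒≡true (AllP.all⁻ _ (All.universal satisfiable (allFin n))))
  where
  satisfiable : ∀ j → T (any (λ s → signCol j s (lookup μ j) (lookup π j)) (signs (lookup κ j)))
  satisfiable j = signCol-satisfiable j (lookup κ j) (lookup μ j) (lookup π j)

module ColumnWeights {c ℓ} (R : CommutativeRing c ℓ) (t tinv : CommutativeRing.Carrier R)
                     {n : ℕ} (x : Fin n → CommutativeRing.Carrier R) where
  open CommutativeRing R
  open Weights R
  open SemiringSums commutativeSemiring
  open import Algebra.Properties.Ring ring using (-‿distribˡ-*; -‿distribʳ-*; -‿involutive)
  open import Relation.Binary.Reasoning.Setoid setoid

  -- e c is the exponent of the weight of the strand ending in column c;
  -- strandCol e j (+ 0) p is the unsigned strand weight of Q̄.
  wtαCol : Fin n → ℤ → Carrier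
  wtαCol j (+ zero)  = 1#
  wtαCol j (+ suc a) = x j
  wtαCol j -[1+ a ]  = - tInvPow t tinv x

  strandCol : (Fin n → ℕ) → Fin n → ℤ → Maybe (Fin n) → Carrier
  strandCol e j s nothing  = 1#
  strandCol e j s (just c) = if toℕ j <ᵇ toℕ c then signedStrand t tinv x s (e c) else 1#

  topCol : Fin n → ℕ → ℕ → Carrier
  topCol j k m =
    if k ≡ᵇ 0 then 1#
    else (if m ≡ᵇ k then x j - tInvPow t tinv x
    else (if k <ᵇ m then x j
    else tInvPow t tinv x))

  columnTerm : (Fin n → ℕ) → Fin n → ℕ → Maybe (Fin n) → ℤ → Carrier
  columnTerm e j m p s = wtαCol j s * strandCol e j s p when signCol j s m p

  -[x]*-[y]≈x*y : ∀ u v → - u * - v ≈ u * v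
  -[x]*-[y]≈x*y u v = begin
    - u * - v     ≈⟨ -‿distribˡ-* u (- v) ⟨
    - (u * - v)   ≈⟨ -‿cong (-‿distribʳ-* u v) ⟨
    - (- (u * v)) ≈⟨ -‿involutive (u * v) ⟩
    u * v         ∎

  column-unpaired : ∀ j m e →
    ∑ (signs 0) (columnTerm e j m nothing) ≈ topCol j 0 m * strandCol e j (+ 0) nothing
  column-unpaired j m e = +-identityʳ _

  -- A straight strand admits both signs, giving x_j - t^(1-n).  Otherwise
  -- exactly one sign is admissible: + when the label below exceeds k, with
  -- weight x_j, and - when it is smaller, where the two minus signs cancel.
  column-paired : ∀ {j c} k m e → k ≢ 0 → j Fin.≤ c → (j ≡ c → m ≡ k) → (j Fin.< c → m ≢ k) →
    ∑ (signs k) (columnTerm e j m (just c)) ≈ topCol j k m * strandCol e j (+ 0) (just c)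
  column-paired zero m e k≢0 _ _ _ = ⊥-elim (k≢0 ≡.refl)
  column-paired {j} {c} (suc a) m e _ j≤c straight crossing with Fin.<-cmp j c
  ... | tri> _ _ c<j = ⊥-elim (ℕ.<⇒≱ c<j j≤c)
  ... | tri≈ _ ≡.refl _
    rewrite straight ≡.refl
          | T⇒≡true {a <ᵇ suc a} (ℕ.<⇒<ᵇ (ℕ.n<1+n a))
          | T⇒≡true {a ≡ᵇ a} (ℕ.≡⇒≡ᵇ a a ≡.refl)
          | T⇒≡true {toℕ j ≡ᵇ toℕ j} (ℕ.≡⇒≡ᵇ (toℕ j) _ ≡.refl)
          | ¬T⇒≡false {toℕ j <ᵇ toℕ j} (ℕ.n≮n (toℕ j) ∘ ℕ.<ᵇ⇒< (toℕ j) (toℕ j))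
    = begin
      x j * 1# + (- tInvPow t tinv x * 1# + 0#) ≈⟨ +-cong refl (+-identityʳ _) ⟩
      x j * 1# + - tInvPow t tinv x * 1#        ≈⟨ distribʳ 1# (x j) _ ⟨
      (x j - tInvPow t tinv x) * 1#             ∎
  ... | tri< j<c _ _ with ℕ.<-cmp m (suc a)
  ...   | tri≈ _ m≡k _ = ⊥-elim (crossing j<c m≡k)
  ...   | tri< m<k _ _
    rewrite T⇒≡true {toℕ j <ᵇ toℕ c} (ℕ.<⇒<ᵇ j<c)
          | ¬T⇒≡false {a <ᵇ m} (ℕ.≤⇒≯ (ℕ.s≤s⁻¹ m<k) ∘ ℕ.<ᵇ⇒< a m)
          | T⇒≡true {m ≤ᵇ suc a} (ℕ.≤⇒≤ᵇ (ℕ.<⇒≤ m<k))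
          | ¬T⇒≡false {m ≡ᵇ suc a} (ℕ.<⇒≢ m<k ∘ ℕ.≡ᵇ⇒≡ m (suc a))
          | ¬T⇒≡false {suc a <ᵇ m} (ℕ.<-asym m<k ∘ ℕ.<ᵇ⇒< (suc a) m)
    = begin
      0# + (- tInvPow t tinv x * - w + 0#) ≈⟨ +-identityˡ _ ⟩
      - tInvPow t tinv x * - w + 0#        ≈⟨ +-identityʳ _ ⟩
      - tInvPow t tinv x * - w             ≈⟨ -[x]*-[y]≈x*y _ w ⟩
      tInvPow t tinv x * w                 ∎
    where
    w : Carrier
    w = (1# - t) * pow t (e c)
  ...   | tri> _ _ k<m
    rewrite T⇒≡true {toℕ j <ᵇ toℕ c} (ℕ.<⇒<ᵇ j<c)
          | T⇒≡true {a <ᵇ m} (ℕ.<⇒<ᵇ (ℕ.<-trans (ℕ.n<1+n a) k<m))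
          | ¬T⇒≡false {m ≡ᵇ suc a} (ℕ.<⇒≢ k<m ∘ ≡.sym ∘ ℕ.≡ᵇ⇒≡ m (suc a))
          | ¬T⇒≡false {m ≤ᵇ suc a} (ℕ.<⇒≱ k<m ∘ ℕ.≤ᵇ⇒≤ m (suc a))
          | T⇒≡true {suc a <ᵇ m} (ℕ.<⇒<ᵇ k<m)
    = trans (+-cong refl (+-identityʳ 0#)) (+-identityʳ _)

  -- The column factors of wtα, queueWt and barWt are local to where-blocks
  -- of Defs; unification against `prodCols F` names them.
  columnFactor : (P : Carrier) {F : Fin n → Carrier} → P ≡ prodCols F → Fin n → Carrier
  columnFactor _ {F} _ = F

  wtα-columns : ∀ α → wtα t tinv x α ≈ ∏[ j ∈ allFin n ] wtαCol j (lookup α j)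
  wtα-columns α = ∏-cong (allFin n) (λ j → reflexive (column j))
    where
    column : ∀ j → columnFactor (wtα t tinv x α) ≡.refl j ≡ wtαCol j (lookup α j)
    column j with lookup α j
    ... | + zero   = ≡.refl
    ... | + suc a  = ≡.refl
    ... | -[1+ a ] = ≡.refl

  barCol : Vec ℕ n → Vec ℕ n → Pairing n → Fin n → Carrier
  barCol κ μ π j =
    topCol j (lookup κ j) (lookup μ j) * strandCol (skipped κ μ π j) j (+ 0) (lookup π j)

  barWt-columns : ∀ κ μ π → barWt t tinv x κ μ π ≈ ∏ (allFin n) (barCol κ μ π)
  barWt-columns κ μ π = ∏-cong (allFin n) (λ j → reflexive (column j))
    where
    column : ∀ j → columnFactor (barWt t tinv x κ μ π) ≡.refl j ≡ barCol κ μ π j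
    column j with lookup π j
    ... | nothing = ≡.refl
    ... | just c  = ≡.refl

  queueTerm : Bool → Vec ℤ n → Vec ℕ n → Pairing n → Carrier
  queueTerm b α μ π = wtα t tinv x α * (queueWt t tinv x α μ π when b)

  module _ (κ μ : Vec ℕ n) (μ-injective : Injective _≡_ _≡_ (lookup μ))
           (covers : Covers κ μ) where

    module _ (π : Pairing n) (ok : T (pairingOK κ μ π)) where
      open Strands κ μ π

      queueWt-columns : ∀ α → absRow α ≡ κ → queueWt t tinv x α μ π ≈
        ∏[ j ∈ allFin n ] strandCol (skipped κ μ π j) j (lookup α j) (lookup π j)
      queueWt-columns α |α|≡κ = ∏-cong (allFin n) (λ j → reflexive (column j))
        where
        column : ∀ j → columnFactor (queueWt t tinv x α μ π) ≡.refl j ≡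
                       strandCol (skipped κ μ π j) j (lookup α j) (lookup π j)
        column j with lookup π j in πj≡c
        ... | nothing = ≡.refl
        ... | just c
          rewrite |α|≡κ
                | emp-vanishes ok μ-injective covers πj≡c
                | ℕ.+-identityʳ (skipped κ μ π j c) = ≡.refl

      columnTerms : Fin n → ℤ → Carrier
      columnTerms j = columnTerm (skipped κ μ π j) j (lookup μ j) (lookup π j)

      column-identity : ∀ j → ∑ (signs (lookup κ j)) (columnTerms j) ≈ barCol κ μ π j
      column-identity j with lookup π j | pairingOK⇒StrandOK ok j
      ... | nothing | κj≡0 rewrite κj≡0 = column-unpaired j (lookup μ j) (skipped κ μ π j)
      ... | just c  | (κj≢0 , j≤c , μc≡κj) =
        column-paired (lookup κ j) (lookup μ j) (skipped κ μ π j) κj≢0 j≤c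
          (λ { ≡.refl → μc≡κj })
          (λ j<c μj≡κj → ℕ.<⇒≢ j<c (≡.cong toℕ (μ-injective (≡.trans μj≡κj (≡.sym μc≡κj)))))

      queueTerm-columns : ∀ α → absRow α ≡ κ →
        queueTerm (signOK α μ π) α μ π ≈ ∏[ j ∈ allFin n ] columnTerms j (lookup α j)
      queueTerm-columns α |α|≡κ = begin
        wtα t tinv x α * (queueWt t tinv x α μ π when signOK α μ π)
          ≈⟨ *-when _ _ (signOK α μ π) ⟩
        wtα t tinv x α * queueWt t tinv x α μ π when signOK α μ π
          ≈⟨ when-cong (signOK α μ π) (*-cong (wtα-columns α) (queueWt-columns α |α|≡κ)) ⟩
        (∏[ j ∈ allFin n ] wtαCol j (lookup α j)) *
        (∏[ j ∈ allFin n ] strandCol (skipped κ μ π j) j (lookup α j) (lookup π j))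
          when signOK α μ π
          ≈⟨ when-cong (signOK α μ π) (∏-* _ _ (allFin n)) ⟩
        ∏[ j ∈ allFin n ] (wtαCol j (lookup α j) *
                           strandCol (skipped κ μ π j) j (lookup α j) (lookup π j))
          when signOK α μ π
          ≈⟨ ∏-all _ _ (allFin n) ⟩
        ∏[ j ∈ allFin n ] columnTerms j (lookup α j) ∎

      ∑-queueTerm : ∑[ α ∈ signings κ ] queueTerm (signOK α μ π) α μ π ≈ barWt t tinv x κ μ π
      ∑-queueTerm = begin
        ∑[ α ∈ signings κ ] queueTerm (signOK α μ π) α μ π
          ≈⟨ ∑-congᴬ (All.map (queueTerm-columns _) (absRow-signings κ)) ⟩
        ∑[ α ∈ signings κ ] ∏[ j ∈ allFin n ] columnTerms j (lookup α j)
          ≈⟨ ∑-signings κ columnTerms ⟩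
        ∏[ j ∈ allFin n ] ∑ (signs (lookup κ j)) (columnTerms j)
          ≈⟨ ∏-cong (allFin n) column-identity ⟩
        ∏ (allFin n) (barCol κ μ π)
          ≈⟨ barWt-columns κ μ π ⟨
        barWt t tinv x κ μ π ∎

    isQueue-signings : ∀ π →
      All (λ α → isQueue α μ π ≡ pairingOK κ μ π ∧ signOK α μ π) (signings κ)
    isQueue-signings π =
      All.map (λ {α} → ≡.cong (λ k → pairingOK k μ π ∧ signOK α μ π)) (absRow-signings κ)

    ∑-queueTerm-by-pairingOK : ∀ π b → pairingOK κ μ π ≡ b →
      ∑[ α ∈ signings κ ] queueTerm (b ∧ signOK α μ π) α μ π ≈
      barWt t tinv x κ μ π when b ∧ any (λ α → signOK α μ π) (signings κ)
    ∑-queueTerm-by-pairingOK π false _  =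
      trans (∑-cong (signings κ) (λ α → zeroʳ _)) (∑-ε (signings κ))
    ∑-queueTerm-by-pairingOK π true  ok = trans (∑-queueTerm π (≡.subst T (≡.sym ok) _))
      (reflexive (≡.cong (barWt t tinv x κ μ π when_) (≡.sym (signOK-satisfiable κ μ π))))

    ∑-queueTerm-pairing : ∀ π →
      ∑[ α ∈ signings κ ] queueTerm (isQueue α μ π) α μ π ≈
      barWt t tinv x κ μ π when any (λ α → isQueue α μ π) (signings κ)
    ∑-queueTerm-pairing π = begin
      ∑[ α ∈ signings κ ] queueTerm (isQueue α μ π) α μ π
        ≈⟨ ∑-congᴬ (All.map (reflexive ∘ ≡.cong (λ b → queueTerm b _ μ π))
                            (isQueue-signings π)) ⟩
      ∑[ α ∈ signings κ ] queueTerm (pairingOK κ μ π ∧ signOK α μ π) α μ π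
        ≈⟨ ∑-queueTerm-by-pairingOK π (pairingOK κ μ π) ≡.refl ⟩
      barWt t tinv x κ μ π when pairingOK κ μ π ∧ any (λ α → signOK α μ π) (signings κ)
        ≡⟨ ≡.cong (barWt t tinv x κ μ π when_) any-isQueue ⟩
      barWt t tinv x κ μ π when any (λ α → isQueue α μ π) (signings κ) ∎
      where
      any-isQueue : pairingOK κ μ π ∧ any (λ α → signOK α μ π) (signings κ) ≡
                    any (λ α → isQueue α μ π) (signings κ)
      any-isQueue = ≡.trans (BoolSums.*-∑ (pairingOK κ μ π) _ (signings κ))
                            (≡.sym (BoolSums.∑-congᴬ (isQueue-signings π)))

    cCoef≈barSum : cCoef t tinv x κ μ ≈ barSum t tinv x κ μ
    cCoef≈barSum = begin
      cCoef t tinv x κ μ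
        ≈⟨ ∑-cong (signings κ) expand ⟩
      ∑[ α ∈ signings κ ] ∑[ π ∈ allPairings n ] queueTerm (isQueue α μ π) α μ π
        ≈⟨ ∑-comm _ (signings κ) (allPairings n) ⟩
      ∑[ π ∈ allPairings n ] ∑[ α ∈ signings κ ] queueTerm (isQueue α μ π) α μ π
        ≈⟨ ∑-cong (allPairings n) ∑-queueTerm-pairing ⟩
      ∑[ π ∈ allPairings n ]
        (barWt t tinv x κ μ π when any (λ α → isQueue α μ π) (signings κ))
        ≈⟨ ∑-filterᵇ _ (barWt t tinv x κ μ) (allPairings n) ⟨
      barSum t tinv x κ μ ∎
      where
      expand : ∀ α → wtα t tinv x α * bCoef t tinv x α μ ≈
                     ∑[ π ∈ allPairings n ] queueTerm (isQueue α μ π) α μ π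
      expand α = trans (*-cong refl (∑-filterᵇ (isQueue α μ) _ (allPairings n)))
                       (*-∑ _ _ (allPairings n))

lemma2p8 : ∀ {c ℓ} (R : CommutativeRing c ℓ) →
    let open CommutativeRing R in
    (t tinv : Carrier) → t * tinv ≈ 1# →
    (n : ℕ) (x : Fin n → Carrier) (lam : Vec ℕ n) → DistinctPartition lam →
    (κ μ : Vec ℕ n) → toList κ ↭ toList lam → toList μ ↭ toList lam →
    Weights.cCoef R t tinv x κ μ ≈ Weights.barSum R t tinv x κ μ
lemma2p8 R t tinv _ n x lam strict κ μ κ↭lam μ↭lam =
  ColumnWeights.cCoef≈barSum R t tinv x κ μ
    (permutation-injective strict μ↭lam)
    (permutation-covers (↭-trans μ↭lam (↭-sym κ↭lam)))
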